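{- The $2$-strong chromatic numbers of $t$-intersecting hypergraphs satisfy $\chi(0,2)=\infty$, $\chi(1,2)=3$, and $\chi(t,2)=2$ for every integer $t\ge 2$.
   Context: A hypergraph $G$ consists of a finite vertex set together with a collection of subsets of it (edges). For an integer $c\ge 2$, a $c$-strong coloring of $G$ is an assignment of colors to its vertices such that every edge $e$ of $G$ contains vertices of at least $\min\{c,|e|\}$ distinct colors. $G$ is $t$-intersecting if every two edges of $G$ have at least $t$ vertices in common (every hypergraph is $0$-intersecting). For integers $c\ge 2$, $t\ge 0$, $\chi(t,c)$ denotes the minimum number of colors that suffices to $c$-strong color every $t$-intersecting hypergraph; $\chi(t,c)=\infty$ means that no finite number of colors suffices for all $t$-intersecting hypergraphs. -}

module Defs where

open import Data.Nat using (ℕ; _≤_; _<_; _⊓_)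
open import Data.Fin using (Fin)
open import Data.Fin.Subset using (Subset; _∩_; ∣_∣) renaming (_∈_ to _∈ₛ_)
open import Data.List using (List)
open import Data.List.Membership.Propositional using (_∈_)
open import Data.List.Relation.Unary.Unique.Propositional using (Unique)
open import Data.Product using (Σ; _×_)
open import Relation.Binary.PropositionalEquality using (_≡_; _≢_)
open import Relation.Nullary using (¬_)
open import Function.Definitions using (Injective)

record Hypergraph : Set where
  field
    n      : ℕ
    edges  : List (Subset n)
    unique : Unique edges
open Hypergraph public

Intersecting : ℕ → Hypergraph → Set
Intersecting t G =
  ∀ (e f : Subset (n G)) → e ∈ edges G → f ∈ edges G → e ≢ f → t ≤ ∣ e ∩ f ∣

AtLeastColors : ∀ {v k} → (Fin v → Fin k) → Subset v → ℕ → Set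
AtLeastColors {v} col e m =
  Σ (Fin m → Fin v) λ g → (∀ i → g i ∈ₛ e) × Injective _≡_ _≡_ (λ i → col (g i))

StrongColoring : (c : ℕ) (G : Hypergraph) (k : ℕ) → (Fin (n G) → Fin k) → Set
StrongColoring c G k col =
  ∀ (e : Subset (n G)) → e ∈ edges G → AtLeastColors col e (c ⊓ ∣ e ∣)

Suffices : (t c k : ℕ) → Set
Suffices t c k =
  ∀ (G : Hypergraph) → Intersecting t G → Σ (Fin (n G) → Fin k) (StrongColoring c G k)

ChiEq : (t c k : ℕ) → Set
ChiEq t c k = Suffices t c k × (∀ m → m < k → ¬ Suffices t c m)

ChiInfinite : (t c : ℕ) → Set
ChiInfinite t c = ∀ k → ¬ Suffices t c k

-- Upper bounds: let e be an edge of minimum size and c ∈ e.  Colour c with 0,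
-- the rest of e with 1 and every vertex outside e with 2.  The edge e sees
-- colours 0 and 1; by minimality any other edge f has a vertex outside e,
-- and by 1-intersection a vertex inside e, so it sees 2 and 0 or 1.  If the
-- hypergraph is 2-intersecting, f even meets e - c, so merging colours 0 and 2
-- still leaves f two colours.
-- Lower bounds: if every pair of vertices is an edge, a 2-strong colouring is
-- injective; the triangle is 1-intersecting, a single pair is t-intersecting
-- for all t, and the hypergraph of all subsets is 0-intersecting.
module Submission where

open import Defs
open import Data.Bool using (true; false)
import Data.Bool.Properties as Bool
open import Data.Empty as Empty using (⊥-elim)
open import Data.Fin using (Fin)
open import Data.Fin.Patterns using (0F; 1F; 2F)
import Data.Fin.Properties as Fin
open import Data.Fin.Subset
  using (Subset; inside; outside; ⊥; _∩_; _∪_; ∣_∣; ⁅_⁆; _⊆_; Nonempty)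
  renaming (_∈_ to _∈ₛ_; _∉_ to _∉ₛ_)
open import Data.Fin.Subset.Properties
  using ( _∈?_; nonempty?; p⊆q⇒∣p∣≤∣q∣; p⊂q⇒∣p∣<∣q∣; ⊆-antisym; ∣⊥∣≡0
        ; x∈⁅x⁆; x∈⁅y⁆⇒x≡y; x≢y⇒x∉⁅y⁆; x∉⁅y⁆⇒x≢y; ∣⁅x⁆∣≡1
        ; x∈p∩q⁻; x∈p∪q⁺; x∈p∪q⁻ )
open import Data.List using (List; []; _∷_; map; _++_)
open import Data.List.Extrema.Nat using (argmin; argmin-sel; f[argmin]≤f[⊤]; f[argmin]≤f[xs])
open import Data.List.Membership.Propositional using (_∈_)
open import Data.List.Membership.Propositional.Properties using (∈-map⁺; ∈-map⁻; ∈-++⁺ˡ; ∈-++⁺ʳ)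
open import Data.List.Relation.Unary.All as All using (All; []; _∷_; all?)
open import Data.List.Relation.Unary.AllPairs using ([]; _∷_)
open import Data.List.Relation.Unary.Any using (here; there)
open import Data.List.Relation.Unary.Unique.Propositional using (Unique)
import Data.List.Relation.Unary.Unique.Propositional.Properties as Unique
open import Data.Nat using (ℕ; zero; suc; _≤_; _<_; _⊓_; z≤n; s≤s; _≤?_)
open import Data.Nat.Properties
  using (≤-refl; ≤-trans; ≤-reflexive; ≤-pred; <⇒≱; ≰⇒>; ≮⇒≥; m≤n⇒m≤1+n; m≤n⇒m⊓n≡m; n<1+n)
open import Data.Product using (Σ; ∃; ∃₂; _×_; _,_; proj₂)
open import Data.Sum using (_⊎_; inj₁; inj₂; [_,_]′)
import Data.Vec as Vec
import Data.Vec.Properties as Vec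
open import Function using (_∘_)
open import Relation.Binary.PropositionalEquality
  using (_≡_; _≢_; refl; sym; trans; cong; subst; subst₂)
open import Relation.Nullary using (¬_; Dec; yes; no; contradiction)
open import Relation.Nullary.Decidable using (_×-dec_; ¬?; decidable-stable; from-yes)

_≟ₛ_ : ∀ {n} (p q : Subset n) → Dec (p ≡ q)
_≟ₛ_ = Vec.≡-dec Bool._≟_

⊆-or-∃∉ : ∀ {n} (p q : Subset n) → p ⊆ q ⊎ ∃ λ x → x ∈ₛ p × x ∉ₛ q
⊆-or-∃∉ p q with Fin.any? (λ x → x ∈? p ×-dec ¬? (x ∈? q))
... | yes p∖q-witness = inj₂ p∖q-witness
... | no ∄ = inj₁ λ {x} x∈p → decidable-stable (x ∈? q) (λ x∉q → ∄ (x , x∈p , x∉q))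

∣p∣>0⇒nonempty : ∀ {n} {p : Subset n} → 0 < ∣ p ∣ → Nonempty p
∣p∣>0⇒nonempty {n} {p} 0<∣p∣ with ⊆-or-∃∉ p ⊥
... | inj₁ p⊆⊥ = contradiction (≤-trans (p⊆q⇒∣p∣≤∣q∣ p⊆⊥) (≤-reflexive (∣⊥∣≡0 n))) (<⇒≱ 0<∣p∣)
... | inj₂ (x , x∈p , _) = x , x∈p

∣p∣>1⇒∃≢ : ∀ {n} {p : Subset n} → 1 < ∣ p ∣ → (v : Fin n) → ∃ λ x → x ∈ₛ p × x ≢ v
∣p∣>1⇒∃≢ {p = p} 1<∣p∣ v with ⊆-or-∃∉ p ⁅ v ⁆
... | inj₁ p⊆⁅v⁆ = contradiction (≤-trans (p⊆q⇒∣p∣≤∣q∣ p⊆⁅v⁆) (≤-reflexive (∣⁅x⁆∣≡1 v))) (<⇒≱ 1<∣p∣)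
... | inj₂ (x , x∈p , x∉⁅v⁆) = x , x∈p , x∉⁅y⁆⇒x≢y x∉⁅v⁆

∈∧∈∧≢⇒∣p∣>1 : ∀ {n} {p : Subset n} {a b} → a ∈ₛ p → b ∈ₛ p → a ≢ b → 1 < ∣ p ∣
∈∧∈∧≢⇒∣p∣>1 {p = p} {a} a∈p b∈p a≢b =
  subst (_< ∣ p ∣) (∣⁅x⁆∣≡1 a) (p⊂q⇒∣p∣<∣q∣ (⁅a⁆⊆p , _ , b∈p , x≢y⇒x∉⁅y⁆ (a≢b ∘ sym)))
  where
  ⁅a⁆⊆p : ⁅ a ⁆ ⊆ p
  ⁅a⁆⊆p x∈⁅a⁆ = subst (_∈ₛ p) (sym (x∈⁅y⁆⇒x≡y a x∈⁅a⁆)) a∈p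

≢∧∣q∣≤∣p∣⇒∃∉ : ∀ {n} {p q : Subset n} → p ≢ q → ∣ q ∣ ≤ ∣ p ∣ → ∃ λ x → x ∈ₛ p × x ∉ₛ q
≢∧∣q∣≤∣p∣⇒∃∉ {p = p} {q} p≢q ∣q∣≤∣p∣ with ⊆-or-∃∉ p q
... | inj₂ x∈p∖q = x∈p∖q
... | inj₁ p⊆q with ⊆-or-∃∉ q p
...   | inj₁ q⊆p = contradiction (⊆-antisym p⊆q q⊆p) p≢q
...   | inj₂ x∈q∖p = contradiction ∣q∣≤∣p∣ (<⇒≱ (p⊂q⇒∣p∣<∣q∣ (p⊆q , x∈q∖p)))

module _ {v k} (col : Fin v → Fin k) where

  AtLeastColors-≤1 : ∀ {f} → ∣ f ∣ ≤ 1 → AtLeastColors col f (2 ⊓ ∣ f ∣)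
  AtLeastColors-≤1 {f} ∣f∣≤1 with ∣ f ∣ in ∣f∣≡
  ... | zero = (λ ()) , (λ ()) , λ { {()} }
  ... | suc zero =
    let x , x∈f = ∣p∣>0⇒nonempty (≤-reflexive (sym ∣f∣≡))
    in (λ _ → x) , (λ _ → x∈f) , λ { {0F} {0F} _ → refl }
  ... | suc (suc _) = contradiction ∣f∣≤1 λ { (s≤s ()) }

  twoColours⇒AtLeastColors : ∀ {f a b} → a ∈ₛ f → b ∈ₛ f → col a ≢ col b →
                             AtLeastColors col f (2 ⊓ ∣ f ∣)
  twoColours⇒AtLeastColors {f} {a} {b} a∈f b∈f ca≢cb =
    subst (AtLeastColors col f) (sym (m≤n⇒m⊓n≡m (∈∧∈∧≢⇒∣p∣>1 a∈f b∈f (ca≢cb ∘ cong col))))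
      (pick , pick∈f , injective)
    where
    pick : Fin 2 → Fin v
    pick 0F = a
    pick 1F = b
    pick∈f : ∀ i → pick i ∈ₛ f
    pick∈f 0F = a∈f
    pick∈f 1F = b∈f
    injective : ∀ {i j} → col (pick i) ≡ col (pick j) → i ≡ j
    injective {0F} {0F} _ = refl
    injective {1F} {1F} _ = refl
    injective {0F} {1F} ca≡cb = contradiction ca≡cb ca≢cb
    injective {1F} {0F} cb≡ca = contradiction (sym cb≡ca) ca≢cb

  star⇒AtLeastColors : ∀ {f c} → c ∈ₛ f → (∀ {x} → x ∈ₛ f → x ≢ c → col x ≢ col c) →
                       AtLeastColors col f (2 ⊓ ∣ f ∣)
  star⇒AtLeastColors {f} {c} c∈f leaves≢c with 2 ≤? ∣ f ∣
  ... | yes 1<∣f∣ =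
    let x , x∈f , x≢c = ∣p∣>1⇒∃≢ 1<∣f∣ c in twoColours⇒AtLeastColors x∈f c∈f (leaves≢c x∈f x≢c)
  ... | no ∣f∣≱2 = AtLeastColors-≤1 (≤-pred (≰⇒> ∣f∣≱2))

  AtLeastColors⇒twoColours : ∀ {f} → AtLeastColors col f 2 →
                             ∃₂ λ a b → a ∈ₛ f × b ∈ₛ f × col a ≢ col b
  AtLeastColors⇒twoColours (pick , pick∈f , injective) =
    pick 0F , pick 1F , pick∈f 0F , pick∈f 1F , λ same → 0≢1 (injective same)
    where
    0≢1 : 0F ≢ 1F
    0≢1 ()

record MinimumEdge (G : Hypergraph) : Set where
  field
    edge    : Subset (n G)
    ∈edges  : edge ∈ edges G
    minimal : ∀ {f} → f ∈ edges G → ∣ edge ∣ ≤ ∣ f ∣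
open MinimumEdge

argmin-∈∧minimal : ∀ {A : Set} (size : A → ℕ) (xs : List A) → xs ≡ [] ⊎
                   ∃ λ m → m ∈ xs × (∀ {y} → y ∈ xs → size m ≤ size y)
argmin-∈∧minimal size [] = inj₁ refl
argmin-∈∧minimal size (x ∷ xs) =
  inj₂ ( argmin size x xs
       , [ here , there ]′ (argmin-sel size x xs)
       , All.lookup (f[argmin]≤f[⊤] {f = size} x xs ∷ f[argmin]≤f[xs] x xs) )

minimumEdge : (G : Hypergraph) → edges G ≡ [] ⊎ MinimumEdge G
minimumEdge G with argmin-∈∧minimal ∣_∣ (edges G)
... | inj₁ edgeless = inj₁ edgeless
... | inj₂ (e , e∈G , e-min) = inj₂ record { edge = e ; ∈edges = e∈G ; minimal = e-min }

outsideMinimumEdge : ∀ {G} (e : MinimumEdge G) {f} → f ∈ edges G → f ≢ edge e →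
                     ∃ λ u → u ∈ₛ f × u ∉ₛ edge e
outsideMinimumEdge e f∈G f≢e = ≢∧∣q∣≤∣p∣⇒∃∉ f≢e (minimal e f∈G)

Suffices-viaMinimumEdge :
  ∀ {t k} → 1 ≤ t →
  (∀ G → Intersecting t G → (e : MinimumEdge G) → ∀ {v} → v ∈ₛ edge e →
     Σ (Fin (n G) → Fin (suc k)) (StrongColoring 2 G (suc k))) →
  Suffices t 2 (suc k)
Suffices-viaMinimumEdge {k = k} 1≤t colourable G I with minimumEdge G
... | inj₁ edgeless = (λ _ → 0F) , λ f f∈G → contradiction (subst (f ∈_) edgeless f∈G) λ ()
... | inj₂ e with nonempty? (edge e)
...   | yes (v , v∈e) = colourable G I e v∈e
...   | no e-empty = (λ _ → 0F) , onlyEdge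
  where
  -- An empty edge meets no other edge, so it is the only edge.
  onlyEdge : StrongColoring 2 G (suc k) (λ _ → 0F)
  onlyEdge f f∈G with f ≟ₛ edge e
  ... | yes refl = AtLeastColors-≤1 _ (m≤n⇒m≤1+n (≮⇒≥ (e-empty ∘ ∣p∣>0⇒nonempty)))
  ... | no f≢e =
    let x , x∈f∩e = ∣p∣>0⇒nonempty (≤-trans 1≤t (I f (edge e) f∈G (∈edges e) f≢e))
    in ⊥-elim (e-empty (x , proj₂ (x∈p∩q⁻ f (edge e) x∈f∩e)))

module StarColouring {m} (e : Subset m) (c : Fin m) where

  colour : Fin m → Fin 3
  colour x with x ∈? e | x Fin.≟ c
  ... | no _  | _     = 2F
  ... | yes _ | yes _ = 0F
  ... | yes _ | no _  = 1F

  colour-centre : c ∈ₛ e → colour c ≡ 0F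
  colour-centre c∈e with c ∈? e | c Fin.≟ c
  ... | no c∉e | _      = contradiction c∈e c∉e
  ... | yes _  | yes _  = refl
  ... | yes _  | no c≢c = contradiction refl c≢c

  colour-leaf : ∀ {x} → x ∈ₛ e → x ≢ c → colour x ≡ 1F
  colour-leaf {x} x∈e x≢c with x ∈? e | x Fin.≟ c
  ... | no x∉e | _      = contradiction x∈e x∉e
  ... | yes _  | yes x≡c = contradiction x≡c x≢c
  ... | yes _  | no _   = refl

  colour-outside : ∀ {x} → x ∉ₛ e → colour x ≡ 2F
  colour-outside {x} x∉e with x ∈? e | x Fin.≟ c
  ... | no _    | _ = refl
  ... | yes x∈e | _ = contradiction x∈e x∉e

  colour-inside : ∀ {x} → x ∈ₛ e → colour x ≢ 2F
  colour-inside {x} x∈e with x ∈? e | x Fin.≟ c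
  ... | no x∉e | _     = contradiction x∈e x∉e
  ... | yes _  | yes _ = λ ()
  ... | yes _  | no _  = λ ()

merge₀₂ : Fin 3 → Fin 2
merge₀₂ 0F = 0F
merge₀₂ 1F = 1F
merge₀₂ 2F = 0F

module _ {G : Hypergraph} (e : MinimumEdge G) {c : Fin (n G)} (c∈e : c ∈ₛ edge e) where
  open StarColouring (edge e) c

  starColouring-strong : Intersecting 1 G → StrongColoring 2 G 3 colour
  starColouring-strong I f f∈G with f ≟ₛ edge e
  ... | yes refl = star⇒AtLeastColors colour c∈e λ x∈e x≢c →
    subst₂ _≢_ (sym (colour-leaf x∈e x≢c)) (sym (colour-centre c∈e)) λ ()
  ... | no f≢e =
    let w , w∈f∩e = ∣p∣>0⇒nonempty (I f (edge e) f∈G (∈edges e) f≢e)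
        w∈f , w∈e = x∈p∩q⁻ f (edge e) w∈f∩e
        u , u∈f , u∉e = outsideMinimumEdge e f∈G f≢e
    in twoColours⇒AtLeastColors colour w∈f u∈f λ same →
         colour-inside w∈e (trans same (colour-outside u∉e))

  mergedStarColouring-strong : Intersecting 2 G → StrongColoring 2 G 2 (merge₀₂ ∘ colour)
  mergedStarColouring-strong I f f∈G with f ≟ₛ edge e
  ... | yes refl = star⇒AtLeastColors (merge₀₂ ∘ colour) c∈e λ x∈e x≢c →
    subst₂ _≢_ (sym (cong merge₀₂ (colour-leaf x∈e x≢c)))
               (sym (cong merge₀₂ (colour-centre c∈e))) λ ()
  ... | no f≢e =
    let w , w∈f∩e , w≢c = ∣p∣>1⇒∃≢ (I f (edge e) f∈G (∈edges e) f≢e) c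
        w∈f , w∈e = x∈p∩q⁻ f (edge e) w∈f∩e
        u , u∈f , u∉e = outsideMinimumEdge e f∈G f≢e
    in twoColours⇒AtLeastColors (merge₀₂ ∘ colour) w∈f u∈f
         (subst₂ _≢_ (sym (cong merge₀₂ (colour-leaf w∈e w≢c)))
                     (sym (cong merge₀₂ (colour-outside u∉e))) λ ())

Intersecting-anti : ∀ {s t} → s ≤ t → ∀ {G} → Intersecting t G → Intersecting s G
Intersecting-anti s≤t I e f e∈G f∈G e≢f = ≤-trans s≤t (I e f e∈G f∈G e≢f)

Suffices-mono : ∀ {s t c k} → s ≤ t → Suffices s c k → Suffices t c k
Suffices-mono s≤t S G I = S G (Intersecting-anti s≤t {G} I)

suffices-1-3 : Suffices 1 2 3
suffices-1-3 = Suffices-viaMinimumEdge ≤-refl λ G I e c∈e →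
  StarColouring.colour _ _ , starColouring-strong e c∈e I

suffices-2-2 : Suffices 2 2 2
suffices-2-2 = Suffices-viaMinimumEdge (s≤s z≤n) λ G I e c∈e →
  merge₀₂ ∘ StarColouring.colour _ _ , mergedStarColouring-strong e c∈e I

pair : ∀ {m} → Fin m → Fin m → Subset m
pair i j = ⁅ i ⁆ ∪ ⁅ j ⁆

PairComplete : Hypergraph → Set
PairComplete G = ∀ {i j : Fin (n G)} → i ≢ j → pair i j ∈ edges G

module _ {v k} (col : Fin v → Fin k) where

  AtLeastColors-pair : ∀ {i j} → i ≢ j → AtLeastColors col (pair i j) (2 ⊓ ∣ pair i j ∣) →
                       col i ≢ col j
  AtLeastColors-pair {i} {j} i≢j coloured ci≡cj =
    let 1<∣ij∣ = ∈∧∈∧≢⇒∣p∣>1 (x∈p∪q⁺ (inj₁ (x∈⁅x⁆ i))) (x∈p∪q⁺ (inj₂ (x∈⁅x⁆ j))) i≢j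
        a , b , a∈ij , b∈ij , ca≢cb =
          AtLeastColors⇒twoColours col
            (subst (AtLeastColors col (pair i j)) (m≤n⇒m⊓n≡m 1<∣ij∣) coloured)
    in ca≢cb (trans (colour≡ci a∈ij) (sym (colour≡ci b∈ij)))
    where
    colour≡ci : ∀ {x} → x ∈ₛ pair i j → col x ≡ col i
    colour≡ci {x} x∈ij with x∈p∪q⁻ ⁅ i ⁆ ⁅ j ⁆ x∈ij
    ... | inj₁ x∈⁅i⁆ = cong col (x∈⁅y⁆⇒x≡y i x∈⁅i⁆)
    ... | inj₂ x∈⁅j⁆ = trans (cong col (x∈⁅y⁆⇒x≡y j x∈⁅j⁆)) (sym ci≡cj)

¬Suffices-pairComplete : ∀ {t k} (G : Hypergraph) → Intersecting t G → PairComplete G → k < n G →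
                         ¬ Suffices t 2 k
¬Suffices-pairComplete G I complete k<n S =
  let col , strong = S G I
      i , j , i<j , ci≡cj = Fin.pigeonhole k<n col
      i≢j = Fin.<⇒≢ i<j
  in AtLeastColors-pair col i≢j (strong (pair i j) (complete i≢j)) ci≡cj

K₂ : Hypergraph
K₂ = record { n = 2 ; edges = pair 0F 1F ∷ [] ; unique = [] ∷ [] }

K₂-intersecting : ∀ t → Intersecting t K₂
K₂-intersecting _ _ _ (here refl) (here refl) e≢f = contradiction refl e≢f

K₂-pairComplete : PairComplete K₂
K₂-pairComplete {0F} {0F} 0≢0 = contradiction refl 0≢0
K₂-pairComplete {0F} {1F} _   = here refl
K₂-pairComplete {1F} {0F} _   = here refl
K₂-pairComplete {1F} {1F} 1≢1 = contradiction refl 1≢1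

triangle-edges : List (Subset 3)
triangle-edges = pair 0F 1F ∷ pair 1F 2F ∷ pair 0F 2F ∷ []

triangle : Hypergraph
triangle = record
  { n = 3 ; edges = triangle-edges ; unique = ((λ ()) ∷ (λ ()) ∷ []) ∷ ((λ ()) ∷ []) ∷ [] ∷ [] }

triangle-intersecting : Intersecting 1 triangle
triangle-intersecting e f e∈T f∈T _ = All.lookup (All.lookup edgesMeet e∈T) f∈T
  where
  edgesMeet : All (λ e → All (λ f → 1 ≤ ∣ e ∩ f ∣) triangle-edges) triangle-edges
  edgesMeet = from-yes (all? (λ e → all? (λ f → 1 ≤? ∣ e ∩ f ∣) triangle-edges) triangle-edges)

triangle-pairComplete : PairComplete triangle
triangle-pairComplete {0F} {0F} 0≢0 = contradiction refl 0≢0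
triangle-pairComplete {0F} {1F} _   = here refl
triangle-pairComplete {0F} {2F} _   = there (there (here refl))
triangle-pairComplete {1F} {0F} _   = here refl
triangle-pairComplete {1F} {1F} 1≢1 = contradiction refl 1≢1
triangle-pairComplete {1F} {2F} _   = there (here refl)
triangle-pairComplete {2F} {0F} _   = there (there (here refl))
triangle-pairComplete {2F} {1F} _   = there (here refl)
triangle-pairComplete {2F} {2F} 2≢2 = contradiction refl 2≢2

subsets : ∀ m → List (Subset m)
subsets zero    = Vec.[] ∷ []
subsets (suc m) = map (inside Vec.∷_) (subsets m) ++ map (outside Vec.∷_) (subsets m)

∈-subsets : ∀ {m} (p : Subset m) → p ∈ subsets m
∈-subsets Vec.[] = here refl
∈-subsets {suc m} (true Vec.∷ p) = ∈-++⁺ˡ (∈-map⁺ (inside Vec.∷_) (∈-subsets p))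
∈-subsets {suc m} (false Vec.∷ p) =
  ∈-++⁺ʳ (map (inside Vec.∷_) (subsets m)) (∈-map⁺ (outside Vec.∷_) (∈-subsets p))

subsets-unique : ∀ m → Unique (subsets m)
subsets-unique zero    = [] ∷ []
subsets-unique (suc m) =
  Unique.++⁺ (Unique.map⁺ Vec.∷-injectiveʳ (subsets-unique m))
             (Unique.map⁺ Vec.∷-injectiveʳ (subsets-unique m))
    λ (in₁ , in₂) → headsDiffer (∈-map⁻ (inside Vec.∷_) in₁) (∈-map⁻ (outside Vec.∷_) in₂)
  where
  headsDiffer : ∀ {q : Subset (suc m)} →
                (∃ λ p → p ∈ subsets m × q ≡ inside Vec.∷ p) →
                (∃ λ p → p ∈ subsets m × q ≡ outside Vec.∷ p) → Empty.⊥
  headsDiffer (_ , _ , refl) (_ , _ , ())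

powerset : ℕ → Hypergraph
powerset m = record { n = m ; edges = subsets m ; unique = subsets-unique m }

powerset-intersecting : ∀ m → Intersecting 0 (powerset m)
powerset-intersecting _ _ _ _ _ _ = z≤n

powerset-pairComplete : ∀ m → PairComplete (powerset m)
powerset-pairComplete m {i} {j} _ = ∈-subsets (pair i j)

mainTheorem1 : ChiInfinite 0 2 × ChiEq 1 2 3 × (∀ (t : ℕ) → 2 ≤ t → ChiEq t 2 2)
mainTheorem1 =
    (λ k → ¬Suffices-pairComplete (powerset (suc k))
             (powerset-intersecting _) (powerset-pairComplete _) (n<1+n k))
  , ( suffices-1-3
    , λ k k<3 → ¬Suffices-pairComplete triangle triangle-intersecting triangle-pairComplete k<3)
  , λ t 2≤t → Suffices-mono 2≤t suffices-2-2
            , λ k k<2 → ¬Suffices-pairComplete K₂ (K₂-intersecting t) K₂-pairComplete k<2
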